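{- For every integer $n\geq 0$, \[ \sum_{k=0}^{n}\binom{n}{k}\bigl(D_k+D_{k+1}\bigr)(n+2)^{n-k}=(n+1)^{n+1} \qquad\text{and}\qquad \sum_{k=0}^{n}\binom{n}{k}D_{k+1}(n+1)^{n-k}=n^{n+1}. \]
   Context: $D_k$ denotes the $k$-th derangement number, i.e. the number of permutations of $\{1,\dots,k\}$ with no fixed points; $D_0=1$, $D_1=0$. The convention $0^0=1$ is used. -}

module Defs where

open import Data.Nat using (ℕ; zero; suc; _+_; _*_; _∸_; _^_; _≡ᵇ_)
open import Data.Bool using (Bool; true; false; _∧_; not)
open import Data.List using (List; []; _∷_; concatMap; map; upTo; length; filter; sum)
open import Data.Nat.Combinatorics using (_C_)
open import Relation.Nullary.Decidable using (T?)
open import Data.Bool using (T)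

insertions : ℕ → List ℕ → List (List ℕ)
insertions x [] = (x ∷ []) ∷ []
insertions x (y ∷ ys) = (x ∷ y ∷ ys) ∷ map (y ∷_) (insertions x ys)

permutations : List ℕ → List (List ℕ)
permutations [] = [] ∷ []
permutations (x ∷ xs) = concatMap (insertions x) (permutations xs)

-- a list l (a permutation of 0..k-1 in one-line notation, l[i] = σ(i))
-- is fixed-point free iff l[i] ≠ i for every position i
fixedPointFreeFrom : ℕ → List ℕ → Bool
fixedPointFreeFrom i [] = true
fixedPointFreeFrom i (y ∷ ys) = not (y ≡ᵇ i) ∧ fixedPointFreeFrom (suc i) ys

D : ℕ → ℕ
D k = length (filter (λ l → T? (fixedPointFreeFrom 0 l)) (permutations (upTo k)))

sumTo : ℕ → (ℕ → ℕ) → ℕ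
sumTo zero f = f 0
sumTo (suc n) f = sumTo n f + f (suc n)

-- With  S n x = Σₖ C(n,k) D_k x^(n-k)  and  S⁺ n x = Σₖ C(n,k) D_(k+1) x^(n-k)
-- both claims follow from  (Pascal) S (n+1) x = x·S n x + S⁺ n x,
-- (absorption) S⁺ (n+1) x = (n+1)(S⁺ n x + S n x)  and, by induction from
-- these, (key) S (n+1) (y+1) = (n+1)·S n (y+1) + y^(n+1).  Pascal and key give
-- (y+1) S n (y+1) + S⁺ n (y+1) = (n+1) S n (y+1) + y^(n+1); y = n yields the
-- second identity and y = n+1 the first.
--
-- Absorption needs D (k+2) = (k+1)(D (k+1) + D k), extracted from the list
-- definition of D: for distinct xs and injective f, the permutations l of xs
-- with l[i] ≠ f i for all i are counted (inserting the head of xs into the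
-- permutations of the tail) by the rook number  rook |xs| r  of the r
-- "forbidden cells" i with f i ∈ xs.  Then D k = rook k k, and the derangement
-- recurrence is a row expansion of rook numbers.

module Submission where

open import Defs
open import Data.Nat using (ℕ; zero; suc; _+_; _*_; _∸_; _^_; _≡ᵇ_; _≤_; _<_; z≤n; s≤s; _!)
open import Data.Nat.Properties
open import Data.Nat.Combinatorics using (_C_; nCk+nC[k+1]≡[n+1]C[k+1]; k>n⇒nCk≡0; nC1≡n)
import Data.Nat.Tactic.RingSolver as ℕ-Ring
open import Data.Integer as ℤ using (ℤ)
import Data.Integer.Properties as ℤ
import Data.Integer.Tactic.RingSolver as ℤ-Ring
open import Data.Bool using (Bool; true; false; _∧_; _∨_; not; if_then_else_; T)
open import Data.List using (List; []; _∷_; map; upTo; length; filter; _++_; concatMap; applyUpTo)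
open import Data.Nat.ListAction using (sum)
open import Data.List.Properties using (length-upTo)
open import Data.List.Relation.Unary.All as All using (All; []; _∷_)
open import Data.List.Relation.Unary.All.Properties using (map⁺; concat⁺)
open import Relation.Nullary.Decidable using (T?)
open import Data.Product using (_×_; _,_)
open import Data.Unit using (⊤; tt)
open import Data.Empty using (⊥; ⊥-elim)
open import Function.Definitions using (Injective)
open import Relation.Binary.PropositionalEquality

≡ᵇ⇒≡′ : ∀ a b → (a ≡ᵇ b) ≡ true → a ≡ b
≡ᵇ⇒≡′ a b e = ≡ᵇ⇒≡ a b (subst T (sym e) tt)

≡ᵇ-refl : ∀ a → (a ≡ᵇ a) ≡ true
≡ᵇ-refl zero = refl
≡ᵇ-refl (suc a) = ≡ᵇ-refl a

≢⇒≡ᵇ-false : ∀ a b → (a ≡ b → ⊥) → (a ≡ᵇ b) ≡ false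
≢⇒≡ᵇ-false a b a≢b with a ≡ᵇ b in e
... | true = ⊥-elim (a≢b (≡ᵇ⇒≡′ a b e))
... | false = refl

_≢ᵇ_ : ℕ → ℕ → Bool
a ≢ᵇ b = not (a ≡ᵇ b)

_∈ᵇ_ : ℕ → List ℕ → Bool
a ∈ᵇ [] = false
a ∈ᵇ (y ∷ l) = (y ≡ᵇ a) ∨ (a ∈ᵇ l)

Distinct : List ℕ → Set
Distinct [] = ⊤
Distinct (x ∷ xs) = (x ∈ᵇ xs ≡ false) × Distinct xs

χ : Bool → ℕ
χ true = 1
χ false = 0

χ-∧ : ∀ a b → χ (a ∧ b) ≡ χ a * χ b
χ-∧ true b = sym (+-identityʳ (χ b))
χ-∧ false b = refl

χ-∨-disjoint : ∀ a b → (a ≡ true → b ≡ false) → χ (a ∨ b) ≡ χ a + χ b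
χ-∨-disjoint true true a⇒¬b with a⇒¬b refl
... | ()
χ-∨-disjoint true false _ = refl
χ-∨-disjoint false b _ = refl

χ-∨-≤ : ∀ a b → χ (a ∨ b) ≤ χ a + χ b
χ-∨-≤ true b = s≤s z≤n
χ-∨-≤ false b = ≤-refl

χ-split : ∀ a b → χ a ≡ χ (a ∧ b) + χ (a ∧ not b)
χ-split true true = refl
χ-split true false = refl
χ-split false b = refl

χ-complement : ∀ a → χ a + χ (not a) ≡ 1
χ-complement true = refl
χ-complement false = refl

count : {A : Set} → (A → Bool) → List A → ℕ
count p [] = 0
count p (x ∷ xs) = χ (p x) + count p xs

length-filter≡count : {A : Set} (p : A → Bool) (xs : List A) →
  length (filter (λ a → T? (p a)) xs) ≡ count p xs
length-filter≡count p [] = refl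
length-filter≡count p (x ∷ xs) with p x
... | true = cong suc (length-filter≡count p xs)
... | false = length-filter≡count p xs

count-cong : {A : Set} (p q : A → Bool) → (∀ a → p a ≡ q a) → ∀ xs → count p xs ≡ count q xs
count-cong p q p≗q [] = refl
count-cong p q p≗q (x ∷ xs) = cong₂ _+_ (cong χ (p≗q x)) (count-cong p q p≗q xs)

count-++ : {A : Set} (p : A → Bool) (xs ys : List A) → count p (xs ++ ys) ≡ count p xs + count p ys
count-++ p [] ys = refl
count-++ p (x ∷ xs) ys = trans (cong (χ (p x) +_) (count-++ p xs ys)) (sym (+-assoc (χ (p x)) _ _))

count-map : {A B : Set} (p : B → Bool) (g : A → B) (xs : List A) →
  count p (map g xs) ≡ count (λ a → p (g a)) xs
count-map p g [] = refl
count-map p g (x ∷ xs) = cong (χ (p (g x)) +_) (count-map p g xs)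

count-∧ˡ : {A : Set} (c : Bool) (q : A → Bool) (xs : List A) →
  count (λ a → c ∧ q a) xs ≡ χ c * count q xs
count-∧ˡ true q xs = sym (+-identityʳ (count q xs))
count-∧ˡ false q [] = refl
count-∧ˡ false q (x ∷ xs) = count-∧ˡ false q xs

count-concatMap : {A B : Set} (p : B → Bool) (h : A → List B) (xs : List A) →
  count p (concatMap h xs) ≡ sum (map (λ a → count p (h a)) xs)
count-concatMap p h [] = refl
count-concatMap p h (x ∷ xs) =
  trans (count-++ p (h x) (concatMap h xs)) (cong (count p (h x) +_) (count-concatMap p h xs))

sumBelow : ℕ → (ℕ → ℕ) → ℕ
sumBelow zero g = 0
sumBelow (suc n) g = g 0 + sumBelow n (λ j → g (suc j))

countBelow : ℕ → (ℕ → Bool) → ℕ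
countBelow n p = sumBelow n (λ j → χ (p j))

sumBelow-cong : ∀ n (f g : ℕ → ℕ) → (∀ j → j < n → f j ≡ g j) → sumBelow n f ≡ sumBelow n g
sumBelow-cong zero f g f≗g = refl
sumBelow-cong (suc n) f g f≗g =
  cong₂ _+_ (f≗g 0 (s≤s z≤n)) (sumBelow-cong n _ _ (λ j j<n → f≗g (suc j) (s≤s j<n)))

sumBelow-mono-≤ : ∀ n (f g : ℕ → ℕ) → (∀ j → f j ≤ g j) → sumBelow n f ≤ sumBelow n g
sumBelow-mono-≤ zero f g f≤g = z≤n
sumBelow-mono-≤ (suc n) f g f≤g = +-mono-≤ (f≤g 0) (sumBelow-mono-≤ n _ _ (λ j → f≤g (suc j)))

sumBelow-+ : ∀ n (f g : ℕ → ℕ) → sumBelow n (λ j → f j + g j) ≡ sumBelow n f + sumBelow n g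
sumBelow-+ zero f g = refl
sumBelow-+ (suc n) f g = begin
    f 0 + g 0 + sumBelow n (λ j → f (suc j) + g (suc j))
  ≡⟨ cong (f 0 + g 0 +_) (sumBelow-+ n (λ j → f (suc j)) (λ j → g (suc j))) ⟩
    f 0 + g 0 + (sumBelow n (λ j → f (suc j)) + sumBelow n (λ j → g (suc j)))
  ≡⟨ +-exchange (f 0) (g 0) _ _ ⟩
    f 0 + sumBelow n (λ j → f (suc j)) + (g 0 + sumBelow n (λ j → g (suc j)))
  ∎
  where
  open ≡-Reasoning
  +-exchange : ∀ a b c d → a + b + (c + d) ≡ a + c + (b + d)
  +-exchange = ℕ-Ring.solve-∀

sumBelow-*ˡ : ∀ n c (f : ℕ → ℕ) → sumBelow n (λ j → c * f j) ≡ c * sumBelow n f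
sumBelow-*ˡ zero c f = sym (*-zeroʳ c)
sumBelow-*ˡ (suc n) c f =
  trans (cong (c * f 0 +_) (sumBelow-*ˡ n c (λ j → f (suc j)))) (sym (*-distribˡ-+ c (f 0) _))

sumBelow-zeros : ∀ n (f : ℕ → ℕ) → (∀ j → f j ≡ 0) → sumBelow n f ≡ 0
sumBelow-zeros zero f f≗0 = refl
sumBelow-zeros (suc n) f f≗0 = cong₂ _+_ (f≗0 0) (sumBelow-zeros n _ (λ j → f≗0 (suc j)))

-- skip j enumerates ℕ ∖ {j} in increasing order.
skip : ℕ → ℕ → ℕ
skip zero p = suc p
skip (suc j) zero = zero
skip (suc j) (suc p) = suc (skip j p)

skip-injective : ∀ j {a b} → skip j a ≡ skip j b → a ≡ b
skip-injective zero e = suc-injective e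
skip-injective (suc j) {zero} {zero} e = refl
skip-injective (suc j) {suc a} {suc b} e = cong suc (skip-injective j (suc-injective e))

sumBelow-skip : ∀ m j (g : ℕ → ℕ) → j ≤ m → sumBelow (suc m) g ≡ g j + sumBelow m (λ p → g (skip j p))
sumBelow-skip m zero g j≤m = refl
sumBelow-skip (suc m) (suc j) g (s≤s j≤m) = begin
    g 0 + sumBelow (suc m) (λ p → g (suc p))
  ≡⟨ cong (g 0 +_) (sumBelow-skip m j (λ p → g (suc p)) j≤m) ⟩
    g 0 + (g (suc j) + rest)
  ≡⟨ x+[y+z]≡y+[x+z] (g 0) (g (suc j)) rest ⟩
    g (suc j) + (g 0 + rest)
  ∎
  where
  open ≡-Reasoning
  rest = sumBelow m (λ p → g (suc (skip j p)))
  x+[y+z]≡y+[x+z] : ∀ x y z → x + (y + z) ≡ y + (x + z)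
  x+[y+z]≡y+[x+z] = ℕ-Ring.solve-∀

countBelow-all : ∀ n (p : ℕ → Bool) → (∀ j → j < n → p j ≡ true) → countBelow n p ≡ n
countBelow-all zero p all = refl
countBelow-all (suc n) p all =
  cong₂ _+_ (cong χ (all 0 (s≤s z≤n))) (countBelow-all n _ (λ j j<n → all (suc j) (s≤s j<n)))

countBelow-unique : ∀ n (p : ℕ → Bool) → (∀ i j → p i ≡ true → p j ≡ true → i ≡ j) → countBelow n p ≤ 1
countBelow-unique zero p unique = z≤n
countBelow-unique (suc n) p unique with p 0 in p0
... | true = ≤-reflexive (cong suc (sumBelow-zeros n _ (λ j → cong χ (others j))))
  where
  others : ∀ j → p (suc j) ≡ false
  others j with p (suc j) in pj
  ... | true with unique (suc j) 0 pj p0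
  ...   | ()
  others j | false = refl
... | false = countBelow-unique n _ (λ i j pi pj → suc-injective (unique (suc i) (suc j) pi pj))

countBelow-∨ : ∀ n (p q : ℕ → Bool) → (∀ j → p j ≡ true → q j ≡ false) →
  countBelow n (λ j → p j ∨ q j) ≡ countBelow n p + countBelow n q
countBelow-∨ n p q disjoint =
  trans (sumBelow-cong n _ _ (λ j _ → χ-∨-disjoint (p j) (q j) (disjoint j)))
        (sumBelow-+ n (λ j → χ (p j)) (λ j → χ (q j)))

countBelow-∨-≤ : ∀ n (p q : ℕ → Bool) → countBelow n (λ j → p j ∨ q j) ≤ countBelow n p + countBelow n q
countBelow-∨-≤ n p q =
  ≤-trans (sumBelow-mono-≤ n _ _ (λ j → χ-∨-≤ (p j) (q j)))
          (≤-reflexive (sumBelow-+ n (λ j → χ (p j)) (λ j → χ (q j))))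

countBelow-partition : ∀ n (p q : ℕ → Bool) →
  countBelow n p + (countBelow n (λ j → not (p j) ∧ q j) + countBelow n (λ j → not (p j) ∧ not (q j))) ≡ n
countBelow-partition n p q = begin
    countBelow n p + (countBelow n (λ j → not (p j) ∧ q j) + countBelow n (λ j → not (p j) ∧ not (q j)))
  ≡⟨ cong (countBelow n p +_) (sym (trans (sumBelow-cong n _ _ (λ j _ → χ-split (not (p j)) (q j)))
                                        (sumBelow-+ n _ _))) ⟩
    countBelow n p + countBelow n (λ j → not (p j))
  ≡⟨ sym (sumBelow-+ n (λ j → χ (p j)) (λ j → χ (not (p j)))) ⟩
    sumBelow n (λ j → χ (p j) + χ (not (p j)))
  ≡⟨ sumBelow-cong n _ _ (λ j _ → χ-complement (p j)) ⟩
    countBelow n (λ _ → true)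
  ≡⟨ countBelow-all n _ (λ _ _ → refl) ⟩
    n
  ∎
  where open ≡-Reasoning

countBelow-restrict : ∀ n (p q : ℕ → Bool) → (∀ j → p j ≡ true → q j ≡ false) →
  countBelow n (λ j → not (p j) ∧ q j) ≡ countBelow n q
countBelow-restrict n p q disjoint = sumBelow-cong n _ _ (λ j _ → cong χ (restrict (p j) (q j) (disjoint j)))
  where
  restrict : ∀ a b → (a ≡ true → b ≡ false) → not a ∧ b ≡ b
  restrict true b a⇒¬b = sym (a⇒¬b refl)
  restrict false b _ = refl

avoids : (ℕ → ℕ) → List ℕ → Bool
avoids f [] = true
avoids f (y ∷ ys) = (y ≢ᵇ f 0) ∧ avoids (λ p → f (suc p)) ys

avoids-cong : ∀ (f g : ℕ → ℕ) → (∀ p → f p ≡ g p) → ∀ l → avoids f l ≡ avoids g l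
avoids-cong f g f≗g [] = refl
avoids-cong f g f≗g (y ∷ ys) =
  cong₂ (λ a b → (y ≢ᵇ a) ∧ b) (f≗g 0) (avoids-cong _ _ (λ p → f≗g (suc p)) ys)

fixedPointFree≡avoids : ∀ i l → fixedPointFreeFrom i l ≡ avoids (i +_) l
fixedPointFree≡avoids i [] = refl
fixedPointFree≡avoids i (y ∷ ys) = cong₂ (λ a b → (y ≢ᵇ a) ∧ b) (sym (+-identityʳ i))
  (trans (fixedPointFree≡avoids (suc i) ys) (avoids-cong _ _ (λ p → sym (+-suc i p)) ys))

-- Inserting x at position j of zs avoids f iff x ≠ f j and zs avoids f on the
-- remaining positions, which are the positions skip j p.
insertions-avoiding : ∀ x zs f → count (avoids f) (insertions x zs) ≡
  sumBelow (suc (length zs)) (λ j → χ (x ≢ᵇ f j) * χ (avoids (λ p → f (skip j p)) zs))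
insertions-avoiding x [] f = trans (+-identityʳ _) (trans (χ-∧ (x ≢ᵇ f 0) true) (sym (+-identityʳ _)))
insertions-avoiding x (y ∷ ys) f = cong₂ _+_ (χ-∧ (x ≢ᵇ f 0) _) (begin
    count (avoids f) (map (y ∷_) (insertions x ys))
  ≡⟨ count-map (avoids f) (y ∷_) (insertions x ys) ⟩
    count (λ z → (y ≢ᵇ f 0) ∧ avoids f⁺ z) (insertions x ys)
  ≡⟨ count-∧ˡ (y ≢ᵇ f 0) (avoids f⁺) (insertions x ys) ⟩
    χ (y ≢ᵇ f 0) * count (avoids f⁺) (insertions x ys)
  ≡⟨ cong (χ (y ≢ᵇ f 0) *_) (insertions-avoiding x ys f⁺) ⟩
    χ (y ≢ᵇ f 0) * sumBelow (suc (length ys)) (λ j → χ (x ≢ᵇ f (suc j)) * tail-avoids j)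
  ≡⟨ sym (sumBelow-*ˡ (suc (length ys)) (χ (y ≢ᵇ f 0)) (λ j → χ (x ≢ᵇ f (suc j)) * tail-avoids j)) ⟩
    sumBelow (suc (length ys)) (λ j → χ (y ≢ᵇ f 0) * (χ (x ≢ᵇ f (suc j)) * tail-avoids j))
  ≡⟨ sumBelow-cong (suc (length ys)) _ _ (λ j _ → reassociate j) ⟩
    sumBelow (suc (length ys)) (λ j → χ (x ≢ᵇ f (suc j)) * χ (avoids (λ p → f (skip (suc j) p)) (y ∷ ys)))
  ∎)
  where
  open ≡-Reasoning
  f⁺ : ℕ → ℕ
  f⁺ p = f (suc p)
  tail-avoids : ℕ → ℕ
  tail-avoids j = χ (avoids (λ p → f (suc (skip j p))) ys)
  reassociate : ∀ j → χ (y ≢ᵇ f 0) * (χ (x ≢ᵇ f (suc j)) * tail-avoids j)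
                    ≡ χ (x ≢ᵇ f (suc j)) * χ (avoids (λ p → f (skip (suc j) p)) (y ∷ ys))
  reassociate j = trans (x*[y*z]≡y*[x*z] (χ (y ≢ᵇ f 0)) (χ (x ≢ᵇ f (suc j))) (tail-avoids j))
                        (cong (χ (x ≢ᵇ f (suc j)) *_) (sym (χ-∧ (y ≢ᵇ f 0) _)))
    where
    x*[y*z]≡y*[x*z] : ∀ a b c → a * (b * c) ≡ b * (a * c)
    x*[y*z]≡y*[x*z] = ℕ-Ring.solve-∀

insertions-length : ∀ x zs → All (λ z → length z ≡ suc (length zs)) (insertions x zs)
insertions-length x [] = refl ∷ []
insertions-length x (y ∷ ys) = refl ∷ map⁺ (All.map (cong suc) (insertions-length x ys))

permutations-length : ∀ xs → All (λ z → length z ≡ length xs) (permutations xs)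
permutations-length [] = refl ∷ []
permutations-length (x ∷ xs) = concat⁺ (map⁺ (All.map lengths (permutations-length xs)))
  where
  lengths : ∀ {z} → length z ≡ length xs → All (λ w → length w ≡ suc (length xs)) (insertions x z)
  lengths {z} |z|≡|xs| = subst (λ k → All (λ w → length w ≡ suc k) (insertions x z)) |z|≡|xs| (insertions-length x z)

insertions-avoiding-sum : ∀ x f m L → All (λ z → length z ≡ m) L →
  sum (map (λ z → count (avoids f) (insertions x z)) L) ≡
  sumBelow (suc m) (λ j → χ (x ≢ᵇ f j) * count (avoids (λ p → f (skip j p))) L)
insertions-avoiding-sum x f m [] [] = sym (sumBelow-zeros (suc m) _ (λ j → *-zeroʳ (χ (x ≢ᵇ f j))))
insertions-avoiding-sum x f m (z ∷ L) (refl ∷ lengths) = begin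
    count (avoids f) (insertions x z) + sum (map (λ z → count (avoids f) (insertions x z)) L)
  ≡⟨ cong₂ _+_ (insertions-avoiding x z f) (insertions-avoiding-sum x f m L lengths) ⟩
    sumBelow (suc m) (λ j → χ (x ≢ᵇ f j) * χ (avoids (f ∘skip j) z)) +
    sumBelow (suc m) (λ j → χ (x ≢ᵇ f j) * count (avoids (f ∘skip j)) L)
  ≡⟨ sym (sumBelow-+ (suc m) (λ j → χ (x ≢ᵇ f j) * χ (avoids (f ∘skip j) z))
                             (λ j → χ (x ≢ᵇ f j) * count (avoids (f ∘skip j)) L)) ⟩
    sumBelow (suc m) (λ j → χ (x ≢ᵇ f j) * χ (avoids (f ∘skip j) z) + χ (x ≢ᵇ f j) * count (avoids (f ∘skip j)) L)
  ≡⟨ sumBelow-cong (suc m) _ _ (λ j _ → sym (*-distribˡ-+ (χ (x ≢ᵇ f j)) (χ (avoids (f ∘skip j) z)) (count (avoids (f ∘skip j)) L))) ⟩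
    sumBelow (suc m) (λ j → χ (x ≢ᵇ f j) * count (avoids (f ∘skip j)) (z ∷ L))
  ∎
  where
  open ≡-Reasoning
  _∘skip_ : (ℕ → ℕ) → ℕ → ℕ → ℕ
  (g ∘skip j) p = g (skip j p)

avoiding : List ℕ → (ℕ → ℕ) → ℕ
avoiding xs f = count (avoids f) (permutations xs)

-- A permutation of x ∷ ys is a permutation of ys with x inserted at some j ≤ |ys|.
avoiding-cons : ∀ x ys f →
  avoiding (x ∷ ys) f ≡ sumBelow (suc (length ys)) (λ j → χ (x ≢ᵇ f j) * avoiding ys (λ p → f (skip j p)))
avoiding-cons x ys f = trans (count-concatMap (avoids f) (insertions x) (permutations ys))
  (insertions-avoiding-sum x f (length ys) (permutations ys) (permutations-length ys))

-- rook m r: the number of permutations of an m-element set avoiding r given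
-- cells that lie in distinct rows and columns, defined by inclusion–exclusion
-- on the last cell (those hitting it are permutations of an (m-1)-set that
-- avoid the other r-1 cells).  It is computed in ℤ because of the subtraction.
rook : ℕ → ℕ → ℤ
rook m zero = ℤ.+ (m !)
rook zero (suc r) = ℤ.+ 0
rook (suc m) (suc r) = rook (suc m) r ℤ.- rook m r

-- The defining recurrence read backwards, guarded by the factor R for R = 0.
rook-pred : ∀ m R → ℤ.+ R ℤ.* rook (suc m) (R ∸ 1) ≡ ℤ.+ R ℤ.* (rook (suc m) R ℤ.+ rook m (R ∸ 1))
rook-pred m zero = refl
rook-pred m (suc r) = cong (ℤ.+ suc r ℤ.*_) (a≡[a-b]+b (rook (suc m) r) (rook m r))
  where
  a≡[a-b]+b : ∀ a b → a ≡ (a ℤ.- b) ℤ.+ b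
  a≡[a-b]+b = ℤ-Ring.solve-∀

-- Row expansion: in an (m+1)-board with R cells and c+1 = m+1-R free columns,
-- the first element goes to one of the R forbidden columns (leaving R-1 cells)
-- or to one of the c+1 free columns (leaving R cells).
rook-row : ∀ c R → rook (suc (c + R)) R ≡ ℤ.+ R ℤ.* rook (c + R) (R ∸ 1) ℤ.+ ℤ.+ suc c ℤ.* rook (c + R) R
rook-row c zero rewrite +-identityʳ c = trans (ℤ.pos-* (suc c) (c !)) (a≡0*b+a _ (ℤ.+ (c !)))
  where
  a≡0*b+a : ∀ a b → a ≡ ℤ.+ 0 ℤ.* b ℤ.+ a
  a≡0*b+a = ℤ-Ring.solve-∀
rook-row c (suc r) rewrite +-suc c r = begin
    rook (suc (suc m)) r ℤ.- X
  ≡⟨ cong (ℤ._- X) (rook-row (suc c) r) ⟩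
    (ℤ.+ r ℤ.* rook (suc m) (r ∸ 1) ℤ.+ ℤ.+ suc (suc c) ℤ.* X) ℤ.- X
  ≡⟨ cong (λ t → (t ℤ.+ ℤ.+ suc (suc c) ℤ.* X) ℤ.- X) (rook-pred m r) ⟩
    (ℤ.+ r ℤ.* (X ℤ.+ E) ℤ.+ ℤ.+ suc (suc c) ℤ.* X) ℤ.- X
  ≡⟨ row-algebra (ℤ.+ r) (ℤ.+ c) E Y X (rook-row c r) ⟩
    ℤ.+ suc r ℤ.* X ℤ.+ ℤ.+ suc c ℤ.* (X ℤ.- Y)
  ∎
  where
  open ≡-Reasoning
  m = c + r
  X = rook (suc m) r
  E = rook m (r ∸ 1)
  Y = rook m r
  row-identity : ∀ r c E Y →
    (r ℤ.* ((r ℤ.* E ℤ.+ (ℤ.+ 1 ℤ.+ c) ℤ.* Y) ℤ.+ E) ℤ.+ (ℤ.+ 1 ℤ.+ (ℤ.+ 1 ℤ.+ c)) ℤ.* (r ℤ.* E ℤ.+ (ℤ.+ 1 ℤ.+ c) ℤ.* Y))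
      ℤ.- (r ℤ.* E ℤ.+ (ℤ.+ 1 ℤ.+ c) ℤ.* Y)
    ≡ (ℤ.+ 1 ℤ.+ r) ℤ.* (r ℤ.* E ℤ.+ (ℤ.+ 1 ℤ.+ c) ℤ.* Y) ℤ.+ (ℤ.+ 1 ℤ.+ c) ℤ.* ((r ℤ.* E ℤ.+ (ℤ.+ 1 ℤ.+ c) ℤ.* Y) ℤ.- Y)
  row-identity = ℤ-Ring.solve-∀
  row-algebra : ∀ r c E Y X → X ≡ r ℤ.* E ℤ.+ (ℤ.+ 1 ℤ.+ c) ℤ.* Y →
    (r ℤ.* (X ℤ.+ E) ℤ.+ (ℤ.+ 1 ℤ.+ (ℤ.+ 1 ℤ.+ c)) ℤ.* X) ℤ.- X ≡ (ℤ.+ 1 ℤ.+ r) ℤ.* X ℤ.+ (ℤ.+ 1 ℤ.+ c) ℤ.* (X ℤ.- Y)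
  row-algebra r c E Y _ refl = row-identity r c E Y

-- The row expansion in the form produced by inserting the first element: c₁ ≤ 1
-- cells lie in the first element's row, R cells in the other rows, and c₃
-- columns are free.
rook-insert : ∀ m c₁ R c₃ → c₁ ≤ 1 → R ≤ m → c₁ + (R + c₃) ≡ suc m →
  ℤ.+ R ℤ.* rook m (R ∸ 1) ℤ.+ ℤ.+ c₃ ℤ.* rook m R ≡ rook (suc m) (c₁ + R)
rook-insert m zero R zero _ R≤m R+0≡1+m =
  ⊥-elim (<-irrefl refl (≤-trans (s≤s R≤m) (≤-reflexive (trans (sym R+0≡1+m) (+-identityʳ R)))))
rook-insert m zero R (suc c) _ _ R+1+c≡1+m with suc-injective (trans (sym R+1+c≡1+m) (trans (+-suc R c) (cong suc (+-comm R c))))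
... | refl = sym (rook-row c R)
rook-insert m (suc zero) R c₃ _ _ 1+R+c₃≡1+m with suc-injective (trans (sym 1+R+c₃≡1+m) (cong suc (+-comm R c₃)))
... | refl = trans (a*E+c*Y≡[a*E+[1+c]*Y]-Y (ℤ.+ R) (ℤ.+ c₃) (rook (c₃ + R) (R ∸ 1)) (rook (c₃ + R) R))
                   (cong (ℤ._- rook (c₃ + R) R) (sym (rook-row c₃ R)))
  where
  a*E+c*Y≡[a*E+[1+c]*Y]-Y : ∀ a c E Y → a ℤ.* E ℤ.+ c ℤ.* Y ≡ (a ℤ.* E ℤ.+ (ℤ.+ 1 ℤ.+ c) ℤ.* Y) ℤ.- Y
  a*E+c*Y≡[a*E+[1+c]*Y]-Y = ℤ-Ring.solve-∀
rook-insert m (suc (suc c₁)) R c₃ (s≤s ()) _ _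

sumBelow-combination : ∀ n (g u v : ℕ → ℕ) (A B : ℤ) →
  (∀ j → j < n → ℤ.+ g j ≡ ℤ.+ u j ℤ.* A ℤ.+ ℤ.+ v j ℤ.* B) →
  ℤ.+ sumBelow n g ≡ ℤ.+ sumBelow n u ℤ.* A ℤ.+ ℤ.+ sumBelow n v ℤ.* B
sumBelow-combination zero g u v A B terms = refl
sumBelow-combination (suc n) g u v A B terms = begin
    ℤ.+ (g 0 + sumBelow n (λ j → g (suc j)))
  ≡⟨ ℤ.pos-+ (g 0) _ ⟩
    ℤ.+ g 0 ℤ.+ ℤ.+ sumBelow n (λ j → g (suc j))
  ≡⟨ cong₂ ℤ._+_ (terms 0 (s≤s z≤n))
       (sumBelow-combination n _ (λ j → u (suc j)) (λ j → v (suc j)) A B (λ j j<n → terms (suc j) (s≤s j<n))) ⟩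
    (ℤ.+ u 0 ℤ.* A ℤ.+ ℤ.+ v 0 ℤ.* B) ℤ.+ (ℤ.+ us ℤ.* A ℤ.+ ℤ.+ vs ℤ.* B)
  ≡⟨ collect (ℤ.+ u 0) (ℤ.+ v 0) (ℤ.+ us) (ℤ.+ vs) A B ⟩
    (ℤ.+ u 0 ℤ.+ ℤ.+ us) ℤ.* A ℤ.+ (ℤ.+ v 0 ℤ.+ ℤ.+ vs) ℤ.* B
  ≡⟨ sym (cong₂ (λ a b → a ℤ.* A ℤ.+ b ℤ.* B) (ℤ.pos-+ (u 0) us) (ℤ.pos-+ (v 0) vs)) ⟩
    ℤ.+ (u 0 + us) ℤ.* A ℤ.+ ℤ.+ (v 0 + vs) ℤ.* B
  ∎
  where
  open ≡-Reasoning
  us = sumBelow n (λ j → u (suc j))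
  vs = sumBelow n (λ j → v (suc j))
  collect : ∀ a b c d A B → (a ℤ.* A ℤ.+ b ℤ.* B) ℤ.+ (c ℤ.* A ℤ.+ d ℤ.* B) ≡ (a ℤ.+ c) ℤ.* A ℤ.+ (b ℤ.+ d) ℤ.* B
  collect = ℤ-Ring.solve-∀

selected-term : ∀ w b h (A B : ℤ) → ℤ.+ h ≡ (if b then A else B) →
  ℤ.+ (χ w * h) ≡ ℤ.+ χ (w ∧ b) ℤ.* A ℤ.+ ℤ.+ χ (w ∧ not b) ℤ.* B
selected-term false b h A B _ = refl
selected-term true true h A B h≡A rewrite +-identityʳ h = trans h≡A (a≡1*a+0*b A B)
  where
  a≡1*a+0*b : ∀ a b → a ≡ ℤ.+ 1 ℤ.* a ℤ.+ ℤ.+ 0 ℤ.* b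
  a≡1*a+0*b = ℤ-Ring.solve-∀
selected-term true false h A B h≡B rewrite +-identityʳ h = trans h≡B (b≡0*a+1*b A B)
  where
  b≡0*a+1*b : ∀ a b → b ≡ ℤ.+ 0 ℤ.* a ℤ.+ ℤ.+ 1 ℤ.* b
  b≡0*a+1*b = ℤ-Ring.solve-∀

value-after-removal : ∀ {A : Set} (g : ℕ → A) b r R → R ≡ χ b + r → g r ≡ (if b then g (R ∸ 1) else g R)
value-after-removal g true r R R≡1+r = cong g (cong (_∸ 1) (sym R≡1+r))
value-after-removal g false r R R≡r = cong g (sym R≡r)

forbidden : List ℕ → (ℕ → ℕ) → ℕ
forbidden xs f = countBelow (length xs) (λ p → f p ∈ᵇ xs)

forbidden-≤ : ∀ ys n (f : ℕ → ℕ) → Injective _≡_ _≡_ f → countBelow n (λ p → f p ∈ᵇ ys) ≤ length ys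
forbidden-≤ [] n f f-inj = ≤-reflexive (sumBelow-zeros n _ (λ _ → refl))
forbidden-≤ (y ∷ ys) n f f-inj = ≤-trans (countBelow-∨-≤ n _ _)
  (+-mono-≤ (countBelow-unique n _ (λ i j yi yj → f-inj (trans (sym (≡ᵇ⇒≡′ y (f i) yi)) (≡ᵇ⇒≡′ y (f j) yj))))
            (forbidden-≤ ys n f f-inj))

avoiding-rook : ∀ xs → Distinct xs → ∀ f → Injective _≡_ _≡_ f → ℤ.+ avoiding xs f ≡ rook (length xs) (forbidden xs f)
avoiding-rook [] _ f f-inj = refl
avoiding-rook (x ∷ ys) (x∉ys , ys-distinct) f f-inj = begin
    ℤ.+ avoiding (x ∷ ys) f
  ≡⟨ cong ℤ.+_ (avoiding-cons x ys f) ⟩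
    ℤ.+ sumBelow (suc m) (λ j → χ (not (hitsX j)) * avoiding ys (λ p → f (skip j p)))
  ≡⟨ sumBelow-combination (suc m) _ (λ j → χ (not (hitsX j) ∧ hitsYs j)) (λ j → χ (not (hitsX j) ∧ not (hitsYs j)))
       (rook m (R ∸ 1)) (rook m R)
       (λ j j≤m → selected-term (not (hitsX j)) (hitsYs j) _ _ _ (remaining j j≤m)) ⟩
    ℤ.+ c₂ ℤ.* rook m (R ∸ 1) ℤ.+ ℤ.+ c₃ ℤ.* rook m R
  ≡⟨ cong (λ k → ℤ.+ k ℤ.* rook m (R ∸ 1) ℤ.+ ℤ.+ c₃ ℤ.* rook m R) c₂≡R ⟩
    ℤ.+ R ℤ.* rook m (R ∸ 1) ℤ.+ ℤ.+ c₃ ℤ.* rook m R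
  ≡⟨ rook-insert m c₁ R c₃ c₁≤1 (forbidden-≤ ys (suc m) f f-inj)
       (trans (cong (λ k → c₁ + (k + c₃)) (sym c₂≡R)) (countBelow-partition (suc m) hitsX hitsYs)) ⟩
    rook (suc m) (c₁ + R)
  ≡⟨ cong (rook (suc m)) (sym (countBelow-∨ (suc m) hitsX hitsYs exclusive)) ⟩
    rook (suc m) (forbidden (x ∷ ys) f)
  ∎
  where
  open ≡-Reasoning
  m = length ys
  hitsX hitsYs : ℕ → Bool
  hitsX j = x ≡ᵇ f j
  hitsYs j = f j ∈ᵇ ys
  R = countBelow (suc m) hitsYs
  c₁ = countBelow (suc m) hitsX
  c₂ = countBelow (suc m) (λ j → not (hitsX j) ∧ hitsYs j)
  c₃ = countBelow (suc m) (λ j → not (hitsX j) ∧ not (hitsYs j))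
  exclusive : ∀ j → hitsX j ≡ true → hitsYs j ≡ false
  exclusive j x≡fj = subst (λ z → z ∈ᵇ ys ≡ false) (≡ᵇ⇒≡′ x (f j) x≡fj) x∉ys
  c₂≡R : c₂ ≡ R
  c₂≡R = countBelow-restrict (suc m) hitsX hitsYs exclusive
  c₁≤1 : c₁ ≤ 1
  c₁≤1 = countBelow-unique (suc m) hitsX (λ i j xi xj → f-inj (trans (sym (≡ᵇ⇒≡′ x (f i) xi)) (≡ᵇ⇒≡′ x (f j) xj)))
  -- Placing x at j leaves the forbidden cells of ys for f ∘ skip j, one fewer if f j ∈ ys.
  remaining : ∀ j → j < suc m →
    ℤ.+ avoiding ys (λ p → f (skip j p)) ≡ (if hitsYs j then rook m (R ∸ 1) else rook m R)
  remaining j (s≤s j≤m) = trans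
    (avoiding-rook ys ys-distinct (λ p → f (skip j p)) (λ e → skip-injective j (f-inj e)))
    (value-after-removal (rook m) (hitsYs j) _ R (sumBelow-skip m j (λ p → χ (hitsYs p)) j≤m))

applyUpTo-distinct : ∀ (h : ℕ → ℕ) → Injective _≡_ _≡_ h → ∀ k → Distinct (applyUpTo h k)
applyUpTo-distinct h h-inj zero = tt
applyUpTo-distinct h h-inj (suc k) =
  absent (λ i → h (suc i)) (h 0) k (λ i e → 0≢1+n (sym (h-inj e))) ,
  applyUpTo-distinct (λ i → h (suc i)) (λ e → suc-injective (h-inj e)) k
  where
  absent : ∀ (g : ℕ → ℕ) a k → (∀ i → g i ≡ a → ⊥) → a ∈ᵇ applyUpTo g k ≡ false
  absent g a zero _ = refl
  absent g a (suc k) g≢a rewrite ≢⇒≡ᵇ-false (g 0) a (g≢a 0) = absent (λ i → g (suc i)) a k (λ i → g≢a (suc i))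

applyUpTo-∈ : ∀ (h : ℕ → ℕ) k p → p < k → h p ∈ᵇ applyUpTo h k ≡ true
applyUpTo-∈ h (suc k) zero _ rewrite ≡ᵇ-refl (h 0) = refl
applyUpTo-∈ h (suc k) (suc p) (s≤s p<k) with h 0 ≡ᵇ h (suc p)
... | true = refl
... | false = applyUpTo-∈ (λ i → h (suc i)) k p p<k

-- Derangements are the permutations avoiding the identity, for which every cell is forbidden.
derangements-rook : ∀ k → ℤ.+ D k ≡ rook k k
derangements-rook k = begin
    ℤ.+ D k
  ≡⟨ cong ℤ.+_ (length-filter≡count (fixedPointFreeFrom 0) (permutations (upTo k))) ⟩
    ℤ.+ count (fixedPointFreeFrom 0) (permutations (upTo k))
  ≡⟨ cong ℤ.+_ (count-cong _ _ (fixedPointFree≡avoids 0) (permutations (upTo k))) ⟩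
    ℤ.+ avoiding (upTo k) (λ p → p)
  ≡⟨ avoiding-rook (upTo k) (applyUpTo-distinct (λ p → p) (λ e → e) k) (λ p → p) (λ e → e) ⟩
    rook (length (upTo k)) (forbidden (upTo k) (λ p → p))
  ≡⟨ cong₂ rook (length-upTo k) (trans (cong (λ n → countBelow n (λ p → p ∈ᵇ upTo k)) (length-upTo k))
                                      (countBelow-all k _ (λ p p<k → applyUpTo-∈ (λ i → i) k p p<k))) ⟩
    rook k k
  ∎
  where open ≡-Reasoning

derangement-recurrence : ∀ k → D (suc (suc k)) ≡ suc k * (D (suc k) + D k)
derangement-recurrence k = ℤ.+-injective (begin
    ℤ.+ D (suc (suc k))
  ≡⟨ derangements-rook (suc (suc k)) ⟩
    rook (suc (suc k)) (suc k) ℤ.- rook (suc k) (suc k)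
  ≡⟨ cong (ℤ._- rook (suc k) (suc k)) (rook-row 0 (suc k)) ⟩
    (ℤ.+ suc k ℤ.* rook (suc k) k ℤ.+ ℤ.+ 1 ℤ.* rook (suc k) (suc k)) ℤ.- rook (suc k) (suc k)
  ≡⟨ cancel (ℤ.+ suc k) (rook (suc k) k) (rook k k) ⟩
    ℤ.+ suc k ℤ.* (rook (suc k) (suc k) ℤ.+ rook k k)
  ≡⟨ sym (cong₂ (λ a b → ℤ.+ suc k ℤ.* (a ℤ.+ b)) (derangements-rook (suc k)) (derangements-rook k)) ⟩
    ℤ.+ suc k ℤ.* (ℤ.+ D (suc k) ℤ.+ ℤ.+ D k)
  ≡⟨ sym (trans (ℤ.pos-* (suc k) _) (cong (ℤ.+ suc k ℤ.*_) (ℤ.pos-+ (D (suc k)) (D k)))) ⟩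
    ℤ.+ (suc k * (D (suc k) + D k))
  ∎)
  where
  open ≡-Reasoning
  -- rook (k+1) (k+1) = X - Y  with  X = rook (k+1) k,  Y = rook k k.
  cancel : ∀ r X Y → (r ℤ.* X ℤ.+ ℤ.+ 1 ℤ.* (X ℤ.- Y)) ℤ.- (X ℤ.- Y) ≡ r ℤ.* ((X ℤ.- Y) ℤ.+ Y)
  cancel = ℤ-Ring.solve-∀

sumTo-shift : ∀ n f → sumTo (suc n) f ≡ f 0 + sumTo n (λ k → f (suc k))
sumTo-shift zero f = refl
sumTo-shift (suc n) f = trans (cong (_+ f (suc (suc n))) (sumTo-shift n f)) (+-assoc (f 0) _ _)

sumTo-cong : ∀ n f g → (∀ k → k ≤ n → f k ≡ g k) → sumTo n f ≡ sumTo n g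
sumTo-cong zero f g f≗g = f≗g 0 z≤n
sumTo-cong (suc n) f g f≗g = cong₂ _+_ (sumTo-cong n f g (λ k k≤n → f≗g k (m≤n⇒m≤1+n k≤n))) (f≗g (suc n) ≤-refl)

sumTo-+ : ∀ n f g → sumTo n (λ k → f k + g k) ≡ sumTo n f + sumTo n g
sumTo-+ zero f g = refl
sumTo-+ (suc n) f g = trans (cong (_+ (f (suc n) + g (suc n))) (sumTo-+ n f g)) (+-exchange (sumTo n f) (sumTo n g) _ _)
  where
  +-exchange : ∀ a b c d → a + b + (c + d) ≡ a + c + (b + d)
  +-exchange = ℕ-Ring.solve-∀

sumTo-*ˡ : ∀ n c f → sumTo n (λ k → c * f k) ≡ c * sumTo n f
sumTo-*ˡ zero c f = refl
sumTo-*ˡ (suc n) c f = trans (cong (_+ c * f (suc n)) (sumTo-*ˡ n c f)) (sym (*-distribˡ-+ c (sumTo n f) (f (suc n))))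

absorption : ∀ n k → suc k * (suc n C suc k) ≡ suc n * (n C k)
absorption zero zero = refl
absorption zero (suc k) = *-zeroʳ (suc (suc k))
absorption (suc n) zero = trans (+-identityʳ _) (trans (nC1≡n (suc (suc n))) (sym (*-identityʳ (suc (suc n)))))
absorption (suc n) (suc k) = begin
    suc (suc k) * (suc (suc n) C suc (suc k))
  ≡⟨ cong (suc (suc k) *_) (sym (nCk+nC[k+1]≡[n+1]C[k+1] (suc n) (suc k))) ⟩
    suc (suc k) * (a + b)
  ≡⟨ expand (suc k) a b ⟩
    a + suc k * a + suc (suc k) * b
  ≡⟨ cong₂ (λ u v → a + u + v) (absorption n k) (absorption n (suc k)) ⟩
    a + suc n * (n C k) + suc n * (n C suc k)
  ≡⟨ collect a (suc n) (n C k) (n C suc k) ⟩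
    a + suc n * (n C k + n C suc k)
  ≡⟨ cong (λ u → a + suc n * u) (nCk+nC[k+1]≡[n+1]C[k+1] n k) ⟩
    suc (suc n) * a
  ∎
  where
  open ≡-Reasoning
  a = suc n C suc k
  b = suc n C suc (suc k)
  expand : ∀ k a b → suc k * (a + b) ≡ a + k * a + suc k * b
  expand = ℕ-Ring.solve-∀
  collect : ∀ a n p q → a + n * p + n * q ≡ a + n * (p + q)
  collect = ℕ-Ring.solve-∀

S : ℕ → ℕ → ℕ
S n x = sumTo n (λ k → (n C k) * D k * x ^ (n ∸ k))

S⁺ : ℕ → ℕ → ℕ
S⁺ n x = sumTo n (λ k → (n C k) * D (suc k) * x ^ (n ∸ k))

S-pascal : ∀ n x → S (suc n) x ≡ x * S n x + S⁺ n x
S-pascal n x = begin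
    S (suc n) x
  ≡⟨ sumTo-shift n F ⟩
    F 0 + sumTo n (λ k → F (suc k))
  ≡⟨ cong (F 0 +_) (trans (sumTo-cong n _ _ (λ k _ → split k)) (sumTo-+ n _ U)) ⟩
    F 0 + (S⁺ n x + sumTo n U)
  ≡⟨ rearrange (F 0) (S⁺ n x) (sumTo n U) ⟩
    (F 0 + sumTo n U) + S⁺ n x
  ≡⟨ cong (_+ S⁺ n x) (trans (sym (sumTo-shift n G)) shifted) ⟩
    x * S n x + S⁺ n x
  ∎
  where
  open ≡-Reasoning
  F U G : ℕ → ℕ
  F k = (suc n C k) * D k * x ^ (suc n ∸ k)
  U k = (n C suc k) * D (suc k) * x ^ (n ∸ k)
  G k = (n C k) * D k * x ^ (suc n ∸ k)
  rearrange : ∀ a t u → a + (t + u) ≡ (a + u) + t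
  rearrange = ℕ-Ring.solve-∀
  distrib : ∀ a b d y → (a + b) * d * y ≡ a * d * y + b * d * y
  distrib = ℕ-Ring.solve-∀
  split : ∀ k → F (suc k) ≡ (n C k) * D (suc k) * x ^ (n ∸ k) + U k
  split k = trans (cong (λ c → c * D (suc k) * x ^ (n ∸ k)) (sym (nCk+nC[k+1]≡[n+1]C[k+1] n k)))
                  (distrib (n C k) (n C suc k) (D (suc k)) (x ^ (n ∸ k)))
  pull-x : ∀ a d x y → a * d * (x * y) ≡ x * (a * d * y)
  pull-x = ℕ-Ring.solve-∀
  -- G is S n x multiplied by x, with a vanishing extra term C(n, n+1).
  shifted : sumTo (suc n) G ≡ x * S n x
  shifted = begin
      sumTo n G + (n C suc n) * D (suc n) * x ^ (n ∸ n)
    ≡⟨ cong (λ c → sumTo n G + c * D (suc n) * x ^ (n ∸ n)) (k>n⇒nCk≡0 (n<1+n n)) ⟩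
      sumTo n G + 0
    ≡⟨ +-identityʳ _ ⟩
      sumTo n G
    ≡⟨ sumTo-cong n _ _ (λ k k≤n → trans (cong (λ e → (n C k) * D k * x ^ e) (+-∸-assoc 1 k≤n))
                                           (pull-x (n C k) (D k) x (x ^ (n ∸ k)))) ⟩
      sumTo n (λ k → x * ((n C k) * D k * x ^ (n ∸ k)))
    ≡⟨ sumTo-*ˡ n x _ ⟩
      x * S n x
    ∎

-- Absorption and the derangement recurrence turn S⁺ (n+1) into S⁺ n + S n.
S⁺-step : ∀ n x → S⁺ (suc n) x ≡ suc n * (S⁺ n x + S n x)
S⁺-step n x = begin
    S⁺ (suc n) x
  ≡⟨ sumTo-shift n F ⟩
    0 + sumTo n (λ k → F (suc k))
  ≡⟨ sumTo-cong n _ _ (λ k _ → term k) ⟩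
    sumTo n (λ k → suc n * ((n C k) * D (suc k) * x ^ (n ∸ k) + (n C k) * D k * x ^ (n ∸ k)))
  ≡⟨ sumTo-*ˡ n (suc n) _ ⟩
    suc n * sumTo n (λ k → (n C k) * D (suc k) * x ^ (n ∸ k) + (n C k) * D k * x ^ (n ∸ k))
  ≡⟨ cong (suc n *_) (sumTo-+ n _ _) ⟩
    suc n * (S⁺ n x + S n x)
  ∎
  where
  open ≡-Reasoning
  F : ℕ → ℕ
  F k = (suc n C k) * D (suc k) * x ^ (suc n ∸ k)
  swap : ∀ a k d₁ d₀ y → a * (k * (d₁ + d₀)) * y ≡ (k * a) * (d₁ + d₀) * y
  swap = ℕ-Ring.solve-∀
  distrib : ∀ n c d₁ d₀ y → (n * c) * (d₁ + d₀) * y ≡ n * (c * d₁ * y + c * d₀ * y)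
  distrib = ℕ-Ring.solve-∀
  term : ∀ k → F (suc k) ≡ suc n * ((n C k) * D (suc k) * x ^ (n ∸ k) + (n C k) * D k * x ^ (n ∸ k))
  term k = begin
      (suc n C suc k) * D (suc (suc k)) * x ^ (n ∸ k)
    ≡⟨ cong (λ d → (suc n C suc k) * d * x ^ (n ∸ k)) (derangement-recurrence k) ⟩
      (suc n C suc k) * (suc k * (D (suc k) + D k)) * x ^ (n ∸ k)
    ≡⟨ swap (suc n C suc k) (suc k) (D (suc k)) (D k) (x ^ (n ∸ k)) ⟩
      (suc k * (suc n C suc k)) * (D (suc k) + D k) * x ^ (n ∸ k)
    ≡⟨ cong (λ c → c * (D (suc k) + D k) * x ^ (n ∸ k)) (absorption n k) ⟩
      (suc n * (n C k)) * (D (suc k) + D k) * x ^ (n ∸ k)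
    ≡⟨ distrib (suc n) (n C k) (D (suc k)) (D k) (x ^ (n ∸ k)) ⟩
      suc n * ((n C k) * D (suc k) * x ^ (n ∸ k) + (n C k) * D k * x ^ (n ∸ k))
    ∎

S-step : ∀ n y → S (suc n) (suc y) ≡ suc n * S n (suc y) + y ^ suc n
S-step zero y = base y
  where
  base : ∀ y → 1 * 1 * (suc y * 1) + 1 * 0 * 1 ≡ 1 * (1 * 1 * 1) + y * 1
  base = ℕ-Ring.solve-∀
S-step (suc m) y = begin
    S (suc (suc m)) x
  ≡⟨ S-pascal (suc m) x ⟩
    x * s₁ + S⁺ (suc m) x
  ≡⟨ cong (x * s₁ +_) (S⁺-step m x) ⟩
    x * s₁ + suc m * (t₀ + s₀)
  ≡⟨ split-x y s₁ (suc m) t₀ s₀ ⟩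
    s₁ + y * s₁ + suc m * (t₀ + s₀)
  ≡⟨ cong (λ z → s₁ + y * z + suc m * (t₀ + s₀)) (S-step m y) ⟩
    s₁ + y * (suc m * s₀ + y ^ suc m) + suc m * (t₀ + s₀)
  ≡⟨ regroup s₁ y (suc m) s₀ (y ^ suc m) t₀ ⟩
    s₁ + suc m * (x * s₀ + t₀) + y ^ suc (suc m)
  ≡⟨ cong (λ z → s₁ + suc m * z + y ^ suc (suc m)) (sym (S-pascal m x)) ⟩
    s₁ + suc m * s₁ + y ^ suc (suc m)
  ∎
  where
  open ≡-Reasoning
  x = suc y
  s₁ = S (suc m) x
  s₀ = S m x
  t₀ = S⁺ m x
  split-x : ∀ y s₁ m t₀ s₀ → suc y * s₁ + m * (t₀ + s₀) ≡ s₁ + y * s₁ + m * (t₀ + s₀)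
  split-x = ℕ-Ring.solve-∀
  regroup : ∀ s₁ y m s₀ p t₀ → s₁ + y * (m * s₀ + p) + m * (t₀ + s₀) ≡ s₁ + m * (suc y * s₀ + t₀) + y * p
  regroup = ℕ-Ring.solve-∀

S⁺-closed : ∀ n y → suc y * S n (suc y) + S⁺ n (suc y) ≡ suc n * S n (suc y) + y ^ suc n
S⁺-closed n y = trans (sym (S-pascal n (suc y))) (S-step n y)

mainTheorem1 : (n : ℕ) →
    (sumTo n (λ k → (n C k) * (D k + D (suc k)) * (n + 2) ^ (n ∸ k)) ≡ (n + 1) ^ (n + 1))
    × (sumTo n (λ k → (n C k) * D (suc k) * (n + 1) ^ (n ∸ k)) ≡ n ^ (n + 1))
mainTheorem1 n = first , second
  where
  -- y = n + 1:  (n+2) S + S⁺ = (n+1) S + (n+1)^(n+1), so S + S⁺ = (n+1)^(n+1).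
  first : sumTo n (λ k → (n C k) * (D k + D (suc k)) * (n + 2) ^ (n ∸ k)) ≡ (n + 1) ^ (n + 1)
  first rewrite +-comm n 2 | +-comm n 1 = begin
      sumTo n (λ k → (n C k) * (D k + D (suc k)) * suc (suc n) ^ (n ∸ k))
    ≡⟨ sumTo-cong n _ _ (λ k _ → distrib (n C k) (D k) (D (suc k)) (suc (suc n) ^ (n ∸ k))) ⟩
      sumTo n (λ k → (n C k) * D k * suc (suc n) ^ (n ∸ k) + (n C k) * D (suc k) * suc (suc n) ^ (n ∸ k))
    ≡⟨ sumTo-+ n _ _ ⟩
      S n (suc (suc n)) + S⁺ n (suc (suc n))
    ≡⟨ +-cancelˡ-≡ (suc n * S n (suc (suc n))) _ _
         (trans (peel (S n (suc (suc n))) (S⁺ n (suc (suc n))) n) (S⁺-closed n (suc n))) ⟩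
      suc n ^ suc n
    ∎
    where
    open ≡-Reasoning
    distrib : ∀ c a b y → c * (a + b) * y ≡ c * a * y + c * b * y
    distrib = ℕ-Ring.solve-∀
    peel : ∀ s t n → suc n * s + (s + t) ≡ suc (suc n) * s + t
    peel = ℕ-Ring.solve-∀
  -- y = n:  (n+1) S + S⁺ = (n+1) S + n^(n+1), so S⁺ = n^(n+1).
  second : sumTo n (λ k → (n C k) * D (suc k) * (n + 1) ^ (n ∸ k)) ≡ n ^ (n + 1)
  second rewrite +-comm n 1 = +-cancelˡ-≡ (suc n * S n (suc n)) _ _ (S⁺-closed n n)
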